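{- For every positive integer $k$, $$RR(x+y+kz=2w) = \begin{cases} \frac{k(k+4)}{4}+1 & \text{if } k\equiv 0 \pmod 4,\\ \frac{(k+2)(k+3)}{4}+1 & \text{if } k\equiv 1 \pmod 4,\\ \frac{(k+2)^2}{4}+1 & \text{if } k\equiv 2 \pmod 4,\\ \frac{(k+1)(k+4)}{4}+1 & \text{if } k\equiv 3 \pmod 4.\end{cases}$$
   Context: A $2$-coloring of $[1,N]=\{1,2,\dots,N\}$ is a map $\chi:[1,N]\to\{0,1\}$; a solution $(x,y,z,w)$ with $x,y,z,w\in[1,N]$ (not necessarily distinct) is monochromatic if $\chi(x)=\chi(y)=\chi(z)=\chi(w)$. For an equation $\mathcal{E}$ in the variables $x,y,z,w$, $RR(\mathcal{E})$ denotes the minimum positive integer $N$ such that every $2$-coloring of $[1,N]$ admits a monochromatic solution to $\mathcal{E}$ in $[1,N]$. -}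

module Defs where

open import Data.Nat using (ℕ; zero; suc; _+_; _*_; _≤_; _<_)
open import Data.Nat.DivMod using (_/_; _%_)
open import Data.Bool using (Bool)
open import Data.Product using (_×_; ∃-syntax)
open import Relation.Binary.PropositionalEquality using (_≡_)
open import Relation.Nullary using (¬_)

InRange : ℕ → ℕ → Set
InRange N x = 1 ≤ x × x ≤ N

-- A 2-coloring of [1,N] is represented as χ : ℕ → Bool (values outside [1,N] irrelevant).
-- Monochromatic solution of x + y + k z = 2 w in [1,N].
MonoSol : (k N : ℕ) → (ℕ → Bool) → Set
MonoSol k N χ = ∃[ x ] ∃[ y ] ∃[ z ] ∃[ w ]
  (InRange N x × InRange N y × InRange N z × InRange N w
   × x + y + k * z ≡ 2 * w
   × χ x ≡ χ y × χ y ≡ χ z × χ z ≡ χ w)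

Forces : ℕ → ℕ → Set
Forces k N = (χ : ℕ → Bool) → MonoSol k N χ

IsRR : ℕ → ℕ → Set
IsRR k R = 1 ≤ R × Forces k R × (∀ N → 1 ≤ N → N < R → ¬ Forces k N)

-- The claimed value (all divisions by 4 are exact in the relevant case).
rrValue : ℕ → ℕ
rrValue k with k % 4
... | 0 = (k * (k + 4)) / 4 + 1
... | 1 = ((k + 2) * (k + 3)) / 4 + 1
... | 2 = ((k + 2) * (k + 2)) / 4 + 1
... | _ = ((k + 1) * (k + 4)) / 4 + 1

-- Upper bounds: call a number red if it has the colour of 1.  For each class of k mod 4,
-- written k = 4n + r, a decision tree queries the colours of a few explicit points
-- (polynomials in n) and every branch ends in an explicit monochromatic solution.
--
-- Lower bounds: for k ≡ 0, 3 (mod 4) colour [1, a] red and (a, N - 1] blue.  A red solution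
-- has 2w ≥ k + 2 > 2a and a blue one has 2w ≥ (k + 2)(a + 1) > 2(N - 1).  For k ≡ 1, 2 the
-- top T = N - 1 joins the red class.  The only red solutions not excluded by size have
-- w = T and exactly one of x, y equal to T, so that T = y + k z with 1 ≤ y ≤ a; this is
-- impossible because T ≡ r (mod k) with a < r ≤ k.  For k = 1 the red numbers 1 and 3 are
-- odd, and three odd numbers never sum to an even one.

module Submission where

open import Defs
open import Data.Nat using (ℕ; _≤_; suc; _+_; _*_; _<_; z≤n; s≤s; s≤s⁻¹; _≤?_; _≟_; NonZero)
open import Data.Nat.Properties
open import Data.Nat.DivMod using (_/_; _%_; [m+kn]%n≡m%n; m*n/n≡m; m<n⇒m%n≡m; %-remove-+ʳ)
open import Data.Nat.Divisibility using (m∣m*n)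
open import Data.Nat.Tactic.RingSolver using (solve)
open import Data.Bool using (Bool; not)
open import Data.Bool.Properties using (¬-not) renaming (_≟_ to _≟ᵇ_)
open import Data.List using (_∷_; [])
open import Data.Product using (_,_; ∃-syntax)
open import Data.Sum using (_⊎_; inj₁; inj₂; [_,_]′)
open import Function using (_∘_)
open import Relation.Nullary using (¬_; Dec; yes; no; does; contradiction)
open import Relation.Nullary.Decidable using (_⊎-dec_; toSum)
open import Relation.Unary using (Decidable)
open import Relation.Binary.PropositionalEquality

m+o≡n⇒m≤n : ∀ {m n} o → m + o ≡ n → m ≤ n
m+o≡n⇒m≤n o refl = m≤m+n _ o

remainder-unique : ∀ {k y r} z q .{{_ : NonZero k}} → y < k → r < k →
                   y + k * z ≡ r + k * q → y ≡ r
remainder-unique {k} {y} {r} z q y<k r<k eq = begin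
  y               ≡⟨ m<n⇒m%n≡m y<k ⟨
  y % k           ≡⟨ %-remove-+ʳ y (m∣m*n z) ⟨
  (y + k * z) % k ≡⟨ cong (_% k) eq ⟩
  (r + k * q) % k ≡⟨ %-remove-+ʳ r (m∣m*n q) ⟩
  r % k           ≡⟨ m<n⇒m%n≡m r<k ⟩
  r               ∎
  where open ≡-Reasoning

positive-remainder-unique : ∀ {k y r} z q → 1 ≤ y → y ≤ k → 1 ≤ r → r ≤ k →
                            y + k * z ≡ r + k * q → y ≡ r
positive-remainder-unique {suc _} z q (s≤s _) y≤k (s≤s _) r≤k eq =
  cong suc (remainder-unique z q y≤k r≤k (suc-injective eq))

module _ (k : ℕ) where

  no-solution-below : ∀ {m c x y z w} → m ≤ x → m ≤ y → m ≤ z → w ≤ c →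
                      2 * c < m + m + k * m → x + y + k * z ≢ 2 * w
  no-solution-below {m} {c} {x} {y} {z} {w} m≤x m≤y m≤z w≤c small eq = <⇒≱ small (begin
    m + m + k * m ≤⟨ +-mono-≤ (+-mono-≤ m≤x m≤y) (*-monoʳ-≤ k m≤z) ⟩
    x + y + k * z ≡⟨ eq ⟩
    2 * w         ≤⟨ *-monoʳ-≤ 2 w≤c ⟩
    2 * c         ∎)
    where open ≤-Reasoning

  no-solution-above : ∀ {m x y z w} → x ≤ m → y ≤ m → z ≤ m →
                      m + m + k * m < 2 * w → x + y + k * z ≢ 2 * w
  no-solution-above {m} {x} {y} {z} {w} x≤m y≤m z≤m large eq = <⇒≱ large (begin
    2 * w         ≡⟨ eq ⟨
    x + y + k * z ≤⟨ +-mono-≤ (+-mono-≤ x≤m y≤m) (*-monoʳ-≤ k z≤m) ⟩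
    m + m + k * m ∎)
    where open ≤-Reasoning

  no-solution-z-top : ∀ {x y T} → 2 ≤ k → 1 ≤ x → x + y + k * T ≢ 2 * T
  no-solution-z-top {x} {y} {T} 2≤k 1≤x eq = <-irrefl (sym eq) (begin-strict
    2 * T         <⟨ +-monoˡ-≤ (2 * T) 1≤x ⟩
    x + 2 * T     ≤⟨ +-mono-≤ (m≤m+n x y) (*-monoˡ-≤ T 2≤k) ⟩
    x + y + k * T ∎)
    where open ≤-Reasoning

  no-solution-xy-top : ∀ {z T} → 1 ≤ k → 1 ≤ z → T + T + k * z ≢ 2 * T
  no-solution-xy-top {z} {T} 1≤k 1≤z eq = <-irrefl (sym eq) (begin-strict
    2 * T         ≡⟨ solve (T ∷ []) ⟩
    T + T + 0     <⟨ +-monoʳ-< (T + T) (*-mono-≤ 1≤k 1≤z) ⟩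
    T + T + k * z ∎)
    where open ≤-Reasoning

  top-solution⇒ : ∀ {y z T} → T + y + k * z ≡ 2 * T → y + k * z ≡ T
  top-solution⇒ {y} {z} {T} eq = +-cancelˡ-≡ T _ _ (begin
    T + (y + k * z) ≡⟨ +-assoc T y (k * z) ⟨
    T + y + k * z   ≡⟨ eq ⟩
    2 * T           ≡⟨ solve (T ∷ []) ⟩
    T + T           ∎)
    where open ≡-Reasoning

-- Colourings without monochromatic solutions

SolutionFree : ℕ → ℕ → (ℕ → Set) → Set
SolutionFree k N P = ∀ {x y z w} → InRange N x → InRange N y → InRange N z → InRange N w →
                     P x → P y → P z → P w → x + y + k * z ≢ 2 * w

dec-agree : ∀ {A B : Set} (a? : Dec A) (b? : Dec B) → does a? ≡ does b? → B → A
dec-agree (yes a) _       _  _ = a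
dec-agree (no _)  (no ¬b) _  b = contradiction b ¬b

colouring-avoids : ∀ {k N} {P : ℕ → Set} (P? : Decidable P) →
                   SolutionFree k N P → SolutionFree k N (¬_ ∘ P) → ¬ MonoSol k N (does ∘ P?)
colouring-avoids {P = P} P? inside outside
  (x , y , z , w , x∈ , y∈ , z∈ , w∈ , eq , x~y , y~z , z~w) =
  [ (λ Pw → inside x∈ y∈ z∈ w∈ (into x~w Pw) (into y~w Pw) (into z~w Pw) Pw eq)
  , (λ ¬Pw → outside x∈ y∈ z∈ w∈ (out x~w ¬Pw) (out y~w ¬Pw) (out z~w ¬Pw) ¬Pw eq)
  ]′ (toSum (P? w))
  where
  y~w = trans y~z z~w
  x~w = trans x~y y~w
  into : ∀ {v} → does (P? v) ≡ does (P? w) → P w → P v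
  into {v} v~w = dec-agree (P? v) (P? w) v~w
  out : ∀ {v} → does (P? v) ≡ does (P? w) → ¬ P w → ¬ P v
  out {v} v~w ¬Pw Pv = ¬Pw (dec-agree (P? w) (P? v) (sym v~w) Pv)

segment : ℕ → ℕ → Bool
segment a v = does (v ≤? a)

segment-avoids : ∀ k a B → 2 * a < 1 + 1 + k * 1 → 2 * B < suc a + suc a + k * suc a →
                 ¬ MonoSol k B (segment a)
segment-avoids k a B red< blue< = colouring-avoids {k} (_≤? a) red blue
  where
  red : SolutionFree k B (_≤ a)
  red (1≤x , _) (1≤y , _) (1≤z , _) _ _ _ _ w≤a = no-solution-below k 1≤x 1≤y 1≤z w≤a red<
  blue : SolutionFree k B (λ v → ¬ v ≤ a)
  blue _ _ _ (_ , w≤B) x≰a y≰a z≰a _ =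
    no-solution-below k (≰⇒> x≰a) (≰⇒> y≰a) (≰⇒> z≰a) w≤B blue<

Red : ℕ → ℕ → ℕ → Set
Red a T v = v ≤ a ⊎ v ≡ T

segmentWithTop : ℕ → ℕ → ℕ → Bool
segmentWithTop a T v = does (v ≤? a ⊎-dec v ≟ T)

segmentWithTop-avoids : ∀ k a B → 2 * B < suc a + suc a + k * suc a →
                        SolutionFree k (suc B) (Red a (suc B)) →
                        ¬ MonoSol k (suc B) (segmentWithTop a (suc B))
segmentWithTop-avoids k a B blue< red =
  colouring-avoids {k} (λ v → v ≤? a ⊎-dec v ≟ suc B) red blue
  where
  blue : SolutionFree k (suc B) (λ v → ¬ Red a (suc B) v)
  blue _ _ _ (_ , w≤T) x∉ y∉ z∉ w∉ =
    no-solution-below k (≰⇒> (x∉ ∘ inj₁)) (≰⇒> (y∉ ∘ inj₁)) (≰⇒> (z∉ ∘ inj₁))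
                      (s≤s⁻¹ (≤∧≢⇒< w≤T (w∉ ∘ inj₂))) blue<

red-solutionFree : ∀ k a T r q → 2 ≤ k → 2 * a < 1 + 1 + k * 1 → a + a + k * a < 2 * T →
                   a < r → r ≤ k → T ≡ r + k * q → SolutionFree k T (Red a T)
red-solutionFree k _ _ _ _ _ red< _ _ _ _ (1≤x , _) (1≤y , _) (1≤z , _) _ _ _ _ (inj₁ w≤a) =
  no-solution-below k 1≤x 1≤y 1≤z w≤a red<
red-solutionFree k a T r q 2≤k _ top< a<r r≤k T≡r+kq (1≤x , _) (1≤y , _) (1≤z , _) _
  x-red y-red z-red (inj₂ refl) = w-top 1≤x 1≤y 1≤z x-red y-red z-red
  where
  -- T ≡ r (mod k) with a < r ≤ k, whereas y + k z ≡ y (mod k) with 1 ≤ y ≤ a.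
  T-unreachable : ∀ {y z} → 1 ≤ y → y ≤ a → y + k * z ≢ T
  T-unreachable {y} {z} 1≤y y≤a eq = <-irrefl y≡r (≤-<-trans y≤a a<r)
    where
    y≡r : y ≡ r
    y≡r = positive-remainder-unique z q 1≤y (≤-trans y≤a (≤-trans (<⇒≤ a<r) r≤k))
                                      (≤-trans (s≤s z≤n) a<r) r≤k (trans eq T≡r+kq)
  w-top : ∀ {x y z} → 1 ≤ x → 1 ≤ y → 1 ≤ z → Red a T x → Red a T y → Red a T z →
          x + y + k * z ≢ 2 * T
  w-top 1≤x _ _ _ _ (inj₂ refl) = no-solution-z-top k 2≤k 1≤x
  w-top _ _ 1≤z (inj₂ refl) (inj₂ refl) (inj₁ _) =
    no-solution-xy-top k {T = T} (≤-trans (s≤s z≤n) 2≤k) 1≤z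
  w-top _ 1≤y _ (inj₂ refl) (inj₁ y≤a) (inj₁ _) eq = T-unreachable 1≤y y≤a (top-solution⇒ k eq)
  w-top {x} {_} {z} 1≤x _ _ (inj₁ x≤a) (inj₂ refl) (inj₁ _) eq =
    T-unreachable 1≤x x≤a (top-solution⇒ k {T = T} (trans (cong (_+ k * z) (+-comm T x)) eq))
  w-top _ _ _ (inj₁ x≤a) (inj₁ y≤a) (inj₁ z≤a) = no-solution-above k {w = T} x≤a y≤a z≤a top<

Red-1-3⇒odd : ∀ {v} → InRange 3 v → Red 1 3 v → ∃[ i ] v ≡ 1 + 2 * i
Red-1-3⇒odd (1≤v , _) (inj₁ v≤1) = 0 , ≤-antisym v≤1 1≤v
Red-1-3⇒odd _         (inj₂ refl) = 1 , refl

red-solutionFree-1 : SolutionFree 1 3 (Red 1 3)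
red-solutionFree-1 {w = w} x∈ y∈ z∈ _ x-red y-red z-red _ eq
  with Red-1-3⇒odd x∈ x-red | Red-1-3⇒odd y∈ y-red | Red-1-3⇒odd z∈ z-red
... | i , refl | j , refl | l , refl =
  even≢odd w (1 + i + j + l) (trans (sym eq) (solve (i ∷ j ∷ l ∷ [])))

MonoSol-mono : ∀ {k N T χ} → N ≤ T → MonoSol k N χ → MonoSol k T χ
MonoSol-mono N≤T (x , y , z , w , (1≤x , x≤N) , (1≤y , y≤N) , (1≤z , z≤N) , (1≤w , w≤N) , rest) =
  x , y , z , w , (1≤x , ≤-trans x≤N N≤T) , (1≤y , ≤-trans y≤N N≤T) , (1≤z , ≤-trans z≤N N≤T) ,
  (1≤w , ≤-trans w≤N N≤T) , rest

isRR : ∀ k {B} χ → Forces k (suc B) → ¬ MonoSol k B χ → IsRR k (suc B)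
isRR k χ forces avoids =
  s≤s z≤n , forces , λ N _ N≤B forcesN → avoids (MonoSol-mono {k} (s≤s⁻¹ N≤B) (forcesN χ))

module Forcing (k N : ℕ) where

  data Colour (χ : ℕ → Bool) (v : ℕ) : Set where
    red  : χ v ≡ χ 1 → Colour χ v
    blue : χ v ≡ not (χ 1) → Colour χ v

  colour : ∀ χ v → Colour χ v
  colour χ v with χ v ≟ᵇ χ 1
  ... | yes same  = red same
  ... | no differ = blue (¬-not differ)

  monochromatic : ∀ {χ b x y z w} → InRange N x → InRange N y → InRange N z → InRange N w →
                  x + y + k * z ≡ 2 * w → χ x ≡ b → χ y ≡ b → χ z ≡ b → χ w ≡ b → MonoSol k N χ
  monochromatic x∈ y∈ z∈ w∈ eq χx χy χz χw =
    _ , _ , _ , _ , x∈ , y∈ , z∈ , w∈ , eq ,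
    trans χx (sym χy) , trans χy (sym χz) , trans χz (sym χw)

-- The classes of k modulo 4

%4-by : ∀ k r q → k ≡ r + q * 4 → k % 4 ≡ r % 4
%4-by _ r q refl = [m+kn]%n≡m%n r q 4

/4+1-by : ∀ m q → m ≡ q * 4 → m / 4 + 1 ≡ suc q
/4+1-by _ q refl = trans (cong (_+ 1) (m*n/n≡m q 4)) (+-comm q 1)

module Case-4n+4 (n : ℕ) where
  open Forcing (4 + 4 * n) (9 + 12 * n + 4 * n * n)

  [1] : InRange (9 + 12 * n + 4 * n * n) 1
  [1] = s≤s z≤n , s≤s z≤n
  [2+n] : InRange (9 + 12 * n + 4 * n * n) (2 + n)
  [2+n] = s≤s z≤n , m+o≡n⇒m≤n (7 + 11 * n + 4 * n * n) (solve (n ∷ []))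
  [3+2n] : InRange (9 + 12 * n + 4 * n * n) (3 + 2 * n)
  [3+2n] = s≤s z≤n , m+o≡n⇒m≤n (6 + 10 * n + 4 * n * n) (solve (n ∷ []))
  [7+8n+2n²] : InRange (9 + 12 * n + 4 * n * n) (7 + 8 * n + 2 * n * n)
  [7+8n+2n²] = s≤s z≤n , m+o≡n⇒m≤n (2 + 4 * n + 2 * n * n) (solve (n ∷ []))
  [9+12n+4n²] : InRange (9 + 12 * n + 4 * n * n) (9 + 12 * n + 4 * n * n)
  [9+12n+4n²] = s≤s z≤n , ≤-refl

  forces : Forces (4 + 4 * n) (9 + 12 * n + 4 * n * n)
  forces χ with colour χ (3 + 2 * n)
  ... | red c₁ = monochromatic [1] [1] [1] [3+2n] (solve (n ∷ [])) refl refl refl c₁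
  ... | blue c₁ with colour χ (9 + 12 * n + 4 * n * n)
  ...   | blue c₂ = monochromatic [3+2n] [3+2n] [3+2n] [9+12n+4n²] (solve (n ∷ [])) c₁ c₁ c₁ c₂
  ...   | red c₂ with colour χ (2 + n)
  ...     | red c₃ = monochromatic [1] [9+12n+4n²] [2+n] [9+12n+4n²] (solve (n ∷ [])) refl c₂ c₃ c₂
  ...     | blue c₃ with colour χ (7 + 8 * n + 2 * n * n)
  ...       | red c₄ = monochromatic [1] [9+12n+4n²] [1] [7+8n+2n²] (solve (n ∷ [])) refl c₂ refl c₄
  ...       | blue c₄ = monochromatic [3+2n] [3+2n] [2+n] [7+8n+2n²] (solve (n ∷ [])) c₁ c₁ c₃ c₄

  colouring : ℕ → Bool
  colouring = segment (2 + 2 * n)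

  avoids : ¬ MonoSol (4 + 4 * n) (8 + 12 * n + 4 * n * n) colouring
  avoids = segment-avoids (4 + 4 * n) (2 + 2 * n) (8 + 12 * n + 4 * n * n)
             (m+o≡n⇒m≤n 1 (solve (n ∷ []))) (m+o≡n⇒m≤n 1 (solve (n ∷ [])))

  rrValue≡ : rrValue (4 + 4 * n) ≡ 9 + 12 * n + 4 * n * n
  -- rrValue branches on k % 4, which is stuck on n until rewritten.
  rrValue≡ rewrite %4-by (4 + 4 * n) 0 (1 + n) (solve (n ∷ [])) =
    /4+1-by ((4 + 4 * n) * (4 + 4 * n + 4)) (8 + 12 * n + 4 * n * n) (solve (n ∷ []))

  isRR-rrValue : IsRR (4 + 4 * n) (rrValue (4 + 4 * n))
  isRR-rrValue rewrite rrValue≡ = isRR (4 + 4 * n) colouring forces avoids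

module Case-4n+5 (n : ℕ) where
  open Forcing (5 + 4 * n) (15 + 15 * n + 4 * n * n)

  [1] : InRange (15 + 15 * n + 4 * n * n) 1
  [1] = s≤s z≤n , s≤s z≤n
  [2] : InRange (15 + 15 * n + 4 * n * n) 2
  [2] = s≤s z≤n , s≤s (s≤s z≤n)
  [2+n] : InRange (15 + 15 * n + 4 * n * n) (2 + n)
  [2+n] = s≤s z≤n , m+o≡n⇒m≤n (13 + 14 * n + 4 * n * n) (solve (n ∷ []))
  [3+2n] : InRange (15 + 15 * n + 4 * n * n) (3 + 2 * n)
  [3+2n] = s≤s z≤n , m+o≡n⇒m≤n (12 + 13 * n + 4 * n * n) (solve (n ∷ []))
  [4+2n] : InRange (15 + 15 * n + 4 * n * n) (4 + 2 * n)
  [4+2n] = s≤s z≤n , m+o≡n⇒m≤n (11 + 13 * n + 4 * n * n) (solve (n ∷ []))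
  [4+7n+4n²] : InRange (15 + 15 * n + 4 * n * n) (4 + 7 * n + 4 * n * n)
  [4+7n+4n²] = s≤s z≤n , m+o≡n⇒m≤n (11 + 8 * n) (solve (n ∷ []))
  [5+2n] : InRange (15 + 15 * n + 4 * n * n) (5 + 2 * n)
  [5+2n] = s≤s z≤n , m+o≡n⇒m≤n (10 + 13 * n + 4 * n * n) (solve (n ∷ []))
  [6+4n] : InRange (15 + 15 * n + 4 * n * n) (6 + 4 * n)
  [6+4n] = s≤s z≤n , m+o≡n⇒m≤n (9 + 11 * n + 4 * n * n) (solve (n ∷ []))
  [7+4n] : InRange (15 + 15 * n + 4 * n * n) (7 + 4 * n)
  [7+4n] = s≤s z≤n , m+o≡n⇒m≤n (8 + 11 * n + 4 * n * n) (solve (n ∷ []))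
  [9+11n+4n²] : InRange (15 + 15 * n + 4 * n * n) (9 + 11 * n + 4 * n * n)
  [9+11n+4n²] = s≤s z≤n , m+o≡n⇒m≤n (6 + 4 * n) (solve (n ∷ []))
  [12+8n] : InRange (15 + 15 * n + 4 * n * n) (12 + 8 * n)
  [12+8n] = s≤s z≤n , m+o≡n⇒m≤n (3 + 7 * n + 4 * n * n) (solve (n ∷ []))
  [13+14n+4n²] : InRange (15 + 15 * n + 4 * n * n) (13 + 14 * n + 4 * n * n)
  [13+14n+4n²] = s≤s z≤n , m+o≡n⇒m≤n (2 + n) (solve (n ∷ []))
  [14+15n+4n²] : InRange (15 + 15 * n + 4 * n * n) (14 + 15 * n + 4 * n * n)
  [14+15n+4n²] = s≤s z≤n , m+o≡n⇒m≤n (1) (solve (n ∷ []))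
  [15+15n+4n²] : InRange (15 + 15 * n + 4 * n * n) (15 + 15 * n + 4 * n * n)
  [15+15n+4n²] = s≤s z≤n , ≤-refl

  when-2-red : ∀ χ → χ 2 ≡ χ 1 → MonoSol (5 + 4 * n) (15 + 15 * n + 4 * n * n) χ
  when-2-red χ c₁ with colour χ (6 + 4 * n)
  ... | red c₂ = monochromatic [1] [1] [2] [6+4n] (solve (n ∷ [])) refl refl c₁ c₂
  ... | blue c₂ with colour χ (4 + 2 * n)
  ...   | red c₃ = monochromatic [1] [2] [1] [4+2n] (solve (n ∷ [])) refl c₁ refl c₃
  ...   | blue c₃ with colour χ (14 + 15 * n + 4 * n * n)
  ...     | blue c₄ = monochromatic [4+2n] [4+2n] [4+2n] [14+15n+4n²] (solve (n ∷ [])) c₃ c₃ c₃ c₄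
  ...     | red c₄ with colour χ (9 + 11 * n + 4 * n * n)
  ...       | red c₅ = monochromatic [9+11n+4n²] [14+15n+4n²] [1] [14+15n+4n²]
                       (solve (n ∷ [])) c₅ c₄ refl c₄
  ...       | blue c₅ with colour χ (4 + 7 * n + 4 * n * n)
  ...         | red c₆ = monochromatic [4+7n+4n²] [14+15n+4n²] [2] [14+15n+4n²]
                         (solve (n ∷ [])) c₆ c₄ c₁ c₄
  ...         | blue c₆ with colour χ (5 + 2 * n)
  ...           | red c₇ = monochromatic [1] [2] [5+2n] [14+15n+4n²] (solve (n ∷ [])) refl c₁ c₇ c₄
  ...           | blue c₇ with colour χ (2 + n)
  ...             | blue c₈ = monochromatic [4+2n] [4+7n+4n²] [2+n] [9+11n+4n²]
                              (solve (n ∷ [])) c₃ c₆ c₈ c₅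
  ...             | red c₈ with colour χ (15 + 15 * n + 4 * n * n)
  ...               | blue c₉ = monochromatic [5+2n] [5+2n] [4+2n] [15+15n+4n²]
                                (solve (n ∷ [])) c₇ c₇ c₃ c₉
  ...               | red c₉ with colour χ (3 + 2 * n)
  ...                 | red c₁₀ = monochromatic [3+2n] [15+15n+4n²] [2+n] [14+15n+4n²]
                                  (solve (n ∷ [])) c₁₀ c₉ c₈ c₄
  ...                 | blue c₁₀ with colour χ (13 + 14 * n + 4 * n * n)
  ...                   | red c₁₁ = monochromatic [1] [15+15n+4n²] [2+n] [13+14n+4n²]
                                    (solve (n ∷ [])) refl c₉ c₈ c₁₁
  ...                   | blue c₁₁ = monochromatic [5+2n] [6+4n] [3+2n] [13+14n+4n²]
                                     (solve (n ∷ [])) c₇ c₂ c₁₀ c₁₁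

  when-2-blue : ∀ χ → χ 2 ≡ not (χ 1) → MonoSol (5 + 4 * n) (15 + 15 * n + 4 * n * n) χ
  when-2-blue χ c₁ with colour χ (7 + 4 * n)
  ... | blue c₂ = monochromatic [2] [2] [2] [7+4n] (solve (n ∷ [])) c₁ c₁ c₁ c₂
  ... | red c₂ with colour χ (12 + 8 * n)
  ...   | red c₃ = monochromatic [12+8n] [7+4n] [1] [12+8n] (solve (n ∷ [])) c₃ c₂ refl c₃
  ...   | blue c₃ = monochromatic [12+8n] [2] [2] [12+8n] (solve (n ∷ [])) c₃ c₁ c₁ c₃

  forces : Forces (5 + 4 * n) (15 + 15 * n + 4 * n * n)
  forces χ with colour χ 2
  ... | red c₁ = when-2-red χ c₁
  ... | blue c₁ = when-2-blue χ c₁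

  colouring : ℕ → Bool
  colouring = segmentWithTop (3 + 2 * n) (14 + 15 * n + 4 * n * n)

  avoids : ¬ MonoSol (5 + 4 * n) (14 + 15 * n + 4 * n * n) colouring
  avoids = segmentWithTop-avoids (5 + 4 * n) (3 + 2 * n) (13 + 15 * n + 4 * n * n)
             (m+o≡n⇒m≤n 1 (solve (n ∷ [])))
             (red-solutionFree (5 + 4 * n) (3 + 2 * n) (14 + 15 * n + 4 * n * n) (4 + 2 * n) (2 + n)
                (s≤s (s≤s z≤n)) (m+o≡n⇒m≤n 0 (solve (n ∷ [])))
                (m+o≡n⇒m≤n (6 + 4 * n) (solve (n ∷ []))) ≤-refl
                (m+o≡n⇒m≤n (1 + 2 * n) (solve (n ∷ []))) (solve (n ∷ [])))

  rrValue≡ : rrValue (5 + 4 * n) ≡ 15 + 15 * n + 4 * n * n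
  rrValue≡ rewrite %4-by (5 + 4 * n) 1 (1 + n) (solve (n ∷ [])) =
    /4+1-by ((5 + 4 * n + 2) * (5 + 4 * n + 3)) (14 + 15 * n + 4 * n * n) (solve (n ∷ []))

  isRR-rrValue : IsRR (5 + 4 * n) (rrValue (5 + 4 * n))
  isRR-rrValue rewrite rrValue≡ = isRR (5 + 4 * n) colouring forces avoids

module Case-4n+2 (n : ℕ) where
  open Forcing (2 + 4 * n) (5 + 8 * n + 4 * n * n)

  [1] : InRange (5 + 8 * n + 4 * n * n) 1
  [1] = s≤s z≤n , s≤s z≤n
  [1+n] : InRange (5 + 8 * n + 4 * n * n) (1 + n)
  [1+n] = s≤s z≤n , m+o≡n⇒m≤n (4 + 7 * n + 4 * n * n) (solve (n ∷ []))
  [1+2n] : InRange (5 + 8 * n + 4 * n * n) (1 + 2 * n)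
  [1+2n] = s≤s z≤n , m+o≡n⇒m≤n (4 + 6 * n + 4 * n * n) (solve (n ∷ []))
  [2+2n] : InRange (5 + 8 * n + 4 * n * n) (2 + 2 * n)
  [2+2n] = s≤s z≤n , m+o≡n⇒m≤n (3 + 6 * n + 4 * n * n) (solve (n ∷ []))
  [2+4n+4n²] : InRange (5 + 8 * n + 4 * n * n) (2 + 4 * n + 4 * n * n)
  [2+4n+4n²] = s≤s z≤n , m+o≡n⇒m≤n (3 + 4 * n) (solve (n ∷ []))
  [3+2n] : InRange (5 + 8 * n + 4 * n * n) (3 + 2 * n)
  [3+2n] = s≤s z≤n , m+o≡n⇒m≤n (2 + 6 * n + 4 * n * n) (solve (n ∷ []))
  [3+6n+4n²] : InRange (5 + 8 * n + 4 * n * n) (3 + 6 * n + 4 * n * n)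
  [3+6n+4n²] = s≤s z≤n , m+o≡n⇒m≤n (2 + 2 * n) (solve (n ∷ []))
  [4+8n+4n²] : InRange (5 + 8 * n + 4 * n * n) (4 + 8 * n + 4 * n * n)
  [4+8n+4n²] = s≤s z≤n , m+o≡n⇒m≤n (1) (solve (n ∷ []))
  [5+8n+4n²] : InRange (5 + 8 * n + 4 * n * n) (5 + 8 * n + 4 * n * n)
  [5+8n+4n²] = s≤s z≤n , ≤-refl

  forces : Forces (2 + 4 * n) (5 + 8 * n + 4 * n * n)
  forces χ with colour χ (2 + 2 * n)
  ... | red c₁ = monochromatic [1] [1] [1] [2+2n] (solve (n ∷ [])) refl refl refl c₁
  ... | blue c₁ with colour χ (4 + 8 * n + 4 * n * n)
  ...   | blue c₂ = monochromatic [2+2n] [2+2n] [2+2n] [4+8n+4n²] (solve (n ∷ [])) c₁ c₁ c₁ c₂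
  ...   | red c₂ with colour χ (2 + 4 * n + 4 * n * n)
  ...     | red c₃ = monochromatic [2+4n+4n²] [4+8n+4n²] [1] [4+8n+4n²]
                     (solve (n ∷ [])) c₃ c₂ refl c₂
  ...     | blue c₃ with colour χ (3 + 6 * n + 4 * n * n)
  ...       | red c₄ = monochromatic [3+6n+4n²] [3+6n+4n²] [1] [4+8n+4n²]
                       (solve (n ∷ [])) c₄ c₄ refl c₂
  ...       | blue c₄ with colour χ (3 + 2 * n)
  ...         | red c₅ = monochromatic [1] [1] [3+2n] [4+8n+4n²] (solve (n ∷ [])) refl refl c₅ c₂
  ...         | blue c₅ with colour χ (1 + 2 * n)
  ...           | blue c₆ = monochromatic [2+2n] [2+2n] [1+2n] [3+6n+4n²]
                            (solve (n ∷ [])) c₁ c₁ c₆ c₄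
  ...           | red c₆ with colour χ (1 + n)
  ...             | blue c₇ = monochromatic [2+2n] [2+4n+4n²] [1+n] [3+6n+4n²]
                              (solve (n ∷ [])) c₁ c₃ c₇ c₄
  ...             | red c₇ with colour χ (5 + 8 * n + 4 * n * n)
  ...               | red c₈ = monochromatic [5+8n+4n²] [1+2n] [1+n] [4+8n+4n²]
                               (solve (n ∷ [])) c₈ c₆ c₇ c₂
  ...               | blue c₈ = monochromatic [3+2n] [3+2n] [2+2n] [5+8n+4n²]
                                (solve (n ∷ [])) c₅ c₅ c₁ c₈

  colouring : ℕ → Bool
  colouring = segmentWithTop (1 + 2 * n) (4 + 8 * n + 4 * n * n)

  avoids : ¬ MonoSol (2 + 4 * n) (4 + 8 * n + 4 * n * n) colouring
  avoids = segmentWithTop-avoids (2 + 4 * n) (1 + 2 * n) (3 + 8 * n + 4 * n * n)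
             (m+o≡n⇒m≤n 1 (solve (n ∷ [])))
             (red-solutionFree (2 + 4 * n) (1 + 2 * n) (4 + 8 * n + 4 * n * n) (2 + 2 * n) (1 + n)
                (s≤s (s≤s z≤n)) (m+o≡n⇒m≤n 1 (solve (n ∷ [])))
                (m+o≡n⇒m≤n (3 + 4 * n) (solve (n ∷ []))) ≤-refl
                (m+o≡n⇒m≤n (2 * n) (solve (n ∷ []))) (solve (n ∷ [])))

  rrValue≡ : rrValue (2 + 4 * n) ≡ 5 + 8 * n + 4 * n * n
  rrValue≡ rewrite %4-by (2 + 4 * n) 2 (n) (solve (n ∷ [])) =
    /4+1-by ((2 + 4 * n + 2) * (2 + 4 * n + 2)) (4 + 8 * n + 4 * n * n) (solve (n ∷ []))

  isRR-rrValue : IsRR (2 + 4 * n) (rrValue (2 + 4 * n))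
  isRR-rrValue rewrite rrValue≡ = isRR (2 + 4 * n) colouring forces avoids

module Case-4n+3 (n : ℕ) where
  open Forcing (3 + 4 * n) (8 + 11 * n + 4 * n * n)

  [1] : InRange (8 + 11 * n + 4 * n * n) 1
  [1] = s≤s z≤n , s≤s z≤n
  [2] : InRange (8 + 11 * n + 4 * n * n) 2
  [2] = s≤s z≤n , s≤s (s≤s z≤n)
  [2+n] : InRange (8 + 11 * n + 4 * n * n) (2 + n)
  [2+n] = s≤s z≤n , m+o≡n⇒m≤n (6 + 10 * n + 4 * n * n) (solve (n ∷ []))
  [3] : InRange (8 + 11 * n + 4 * n * n) 3
  [3] = s≤s z≤n , s≤s (s≤s (s≤s z≤n))
  [3+2n] : InRange (8 + 11 * n + 4 * n * n) (3 + 2 * n)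
  [3+2n] = s≤s z≤n , m+o≡n⇒m≤n (5 + 9 * n + 4 * n * n) (solve (n ∷ []))
  [4+2n] : InRange (8 + 11 * n + 4 * n * n) (4 + 2 * n)
  [4+2n] = s≤s z≤n , m+o≡n⇒m≤n (4 + 9 * n + 4 * n * n) (solve (n ∷ []))
  [4+4n] : InRange (8 + 11 * n + 4 * n * n) (4 + 4 * n)
  [4+4n] = s≤s z≤n , m+o≡n⇒m≤n (4 + 7 * n + 4 * n * n) (solve (n ∷ []))
  [5+4n] : InRange (8 + 11 * n + 4 * n * n) (5 + 4 * n)
  [5+4n] = s≤s z≤n , m+o≡n⇒m≤n (3 + 7 * n + 4 * n * n) (solve (n ∷ []))
  [5+7n+4n²] : InRange (8 + 11 * n + 4 * n * n) (5 + 7 * n + 4 * n * n)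
  [5+7n+4n²] = s≤s z≤n , m+o≡n⇒m≤n (3 + 4 * n) (solve (n ∷ []))
  [6+6n] : InRange (8 + 11 * n + 4 * n * n) (6 + 6 * n)
  [6+6n] = s≤s z≤n , m+o≡n⇒m≤n (2 + 5 * n + 4 * n * n) (solve (n ∷ []))
  [7+9n+2n²] : InRange (8 + 11 * n + 4 * n * n) (7 + 9 * n + 2 * n * n)
  [7+9n+2n²] = s≤s z≤n , m+o≡n⇒m≤n (1 + 2 * n + 2 * n * n) (solve (n ∷ []))
  [7+10n+4n²] : InRange (8 + 11 * n + 4 * n * n) (7 + 10 * n + 4 * n * n)
  [7+10n+4n²] = s≤s z≤n , m+o≡n⇒m≤n (1 + n) (solve (n ∷ []))
  [8+8n] : InRange (8 + 11 * n + 4 * n * n) (8 + 8 * n)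
  [8+8n] = s≤s z≤n , m+o≡n⇒m≤n (3 * n + 4 * n * n) (solve (n ∷ []))
  [8+11n+4n²] : InRange (8 + 11 * n + 4 * n * n) (8 + 11 * n + 4 * n * n)
  [8+11n+4n²] = s≤s z≤n , ≤-refl

  when-2-red : ∀ χ → χ 2 ≡ χ 1 → MonoSol (3 + 4 * n) (8 + 11 * n + 4 * n * n) χ
  when-2-red χ c₁ with colour χ (4 + 4 * n)
  ... | red c₂ = monochromatic [1] [1] [2] [4+4n] (solve (n ∷ [])) refl refl c₁ c₂
  ... | blue c₂ with colour χ (3 + 2 * n)
  ...   | red c₃ = monochromatic [1] [2] [1] [3+2n] (solve (n ∷ [])) refl c₁ refl c₃
  ...   | blue c₃ with colour χ (8 + 8 * n)
  ...     | red c₄ = monochromatic [8+8n] [2] [2] [8+8n] (solve (n ∷ [])) c₄ c₁ c₁ c₄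
  ...     | blue c₄ with colour χ 3
  ...       | blue c₅ = monochromatic [3] [4+4n] [3] [8+8n] (solve (n ∷ [])) c₅ c₂ c₅ c₄
  ...       | red c₅ with colour χ (6 + 6 * n)
  ...         | red c₆ = monochromatic [1] [2] [3] [6+6n] (solve (n ∷ [])) refl c₁ c₅ c₆
  ...         | blue c₆ with colour χ (4 + 2 * n)
  ...           | red c₇ = monochromatic [2] [3] [1] [4+2n] (solve (n ∷ [])) c₁ c₅ refl c₇
  ...           | blue c₇ with colour χ (8 + 11 * n + 4 * n * n)
  ...             | blue c₈ = monochromatic [3+2n] [4+2n] [3+2n] [8+11n+4n²]
                              (solve (n ∷ [])) c₃ c₇ c₃ c₈
  ...             | red c₈ with colour χ (5 + 7 * n + 4 * n * n)
  ...               | red c₉ = monochromatic [5+7n+4n²] [8+11n+4n²] [1] [8+11n+4n²]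
                               (solve (n ∷ [])) c₉ c₈ refl c₈
  ...               | blue c₉ with colour χ (2 + n)
  ...                 | red c₁₀ = monochromatic [2] [8+11n+4n²] [2+n] [8+11n+4n²]
                                  (solve (n ∷ [])) c₁ c₈ c₁₀ c₈
  ...                 | blue c₁₀ with colour χ (7 + 10 * n + 4 * n * n)
  ...                   | blue c₁₁ = monochromatic [3+2n] [5+7n+4n²] [2+n] [7+10n+4n²]
                                     (solve (n ∷ [])) c₃ c₉ c₁₀ c₁₁
  ...                   | red c₁₁ with colour χ (7 + 9 * n + 2 * n * n)
  ...                     | red c₁₂ = monochromatic [7+10n+4n²] [1] [2] [7+9n+2n²]
                                      (solve (n ∷ [])) c₁₁ refl c₁ c₁₂
  ...                     | blue c₁₂ = monochromatic [6+6n] [2+n] [2+n] [7+9n+2n²]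
                                       (solve (n ∷ [])) c₆ c₁₀ c₁₀ c₁₂

  when-2-blue : ∀ χ → χ 2 ≡ not (χ 1) → MonoSol (3 + 4 * n) (8 + 11 * n + 4 * n * n) χ
  when-2-blue χ c₁ with colour χ (5 + 4 * n)
  ... | blue c₂ = monochromatic [2] [2] [2] [5+4n] (solve (n ∷ [])) c₁ c₁ c₁ c₂
  ... | red c₂ with colour χ (8 + 8 * n)
  ...   | red c₃ = monochromatic [8+8n] [5+4n] [1] [8+8n] (solve (n ∷ [])) c₃ c₂ refl c₃
  ...   | blue c₃ = monochromatic [8+8n] [2] [2] [8+8n] (solve (n ∷ [])) c₃ c₁ c₁ c₃

  forces : Forces (3 + 4 * n) (8 + 11 * n + 4 * n * n)
  forces χ with colour χ 2
  ... | red c₁ = when-2-red χ c₁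
  ... | blue c₁ = when-2-blue χ c₁

  colouring : ℕ → Bool
  colouring = segment (2 + 2 * n)

  avoids : ¬ MonoSol (3 + 4 * n) (7 + 11 * n + 4 * n * n) colouring
  avoids = segment-avoids (3 + 4 * n) (2 + 2 * n) (7 + 11 * n + 4 * n * n)
             (m+o≡n⇒m≤n 0 (solve (n ∷ []))) (m+o≡n⇒m≤n 0 (solve (n ∷ [])))

  rrValue≡ : rrValue (3 + 4 * n) ≡ 8 + 11 * n + 4 * n * n
  rrValue≡ rewrite %4-by (3 + 4 * n) 3 (n) (solve (n ∷ [])) =
    /4+1-by ((3 + 4 * n + 1) * (3 + 4 * n + 4)) (7 + 11 * n + 4 * n * n) (solve (n ∷ []))

  isRR-rrValue : IsRR (3 + 4 * n) (rrValue (3 + 4 * n))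
  isRR-rrValue rewrite rrValue≡ = isRR (3 + 4 * n) colouring forces avoids

module Case-1 where
  open Forcing 1 4

  [1] : InRange 4 1
  [1] = s≤s z≤n , m+o≡n⇒m≤n 3 refl
  [2] : InRange 4 2
  [2] = s≤s z≤n , m+o≡n⇒m≤n 2 refl
  [3] : InRange 4 3
  [3] = s≤s z≤n , m+o≡n⇒m≤n 1 refl
  [4] : InRange 4 4
  [4] = s≤s z≤n , ≤-refl

  forces : Forces 1 4
  forces χ with colour χ 2
  ... | red c₁ = monochromatic [2] [1] [1] [2] refl c₁ refl refl c₁
  ... | blue c₁ with colour χ 3
  ...   | blue c₂ = monochromatic [2] [2] [2] [3] refl c₁ c₁ c₁ c₂
  ...   | red c₂ with colour χ 4
  ...     | red c₃ = monochromatic [4] [1] [1] [3] refl c₃ refl refl c₂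
  ...     | blue c₃ = monochromatic [4] [2] [2] [4] refl c₃ c₁ c₁ c₃

  avoids : ¬ MonoSol 1 3 (segmentWithTop 1 3)
  avoids = segmentWithTop-avoids 1 1 2 (m+o≡n⇒m≤n 1 refl) red-solutionFree-1

  isRR-rrValue : IsRR 1 (rrValue 1)
  isRR-rrValue = isRR 1 (segmentWithTop 1 3) forces avoids

data ResidueClass : ℕ → Set where
  one  : ResidueClass 1
  4n+4 : ∀ n → ResidueClass (4 + 4 * n)
  4n+5 : ∀ n → ResidueClass (5 + 4 * n)
  4n+2 : ∀ n → ResidueClass (2 + 4 * n)
  4n+3 : ∀ n → ResidueClass (3 + 4 * n)

ResidueClass-4+ : ∀ {k} → ResidueClass k → ResidueClass (4 + k)
ResidueClass-4+ one      = 4n+5 0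
ResidueClass-4+ (4n+4 n) = subst ResidueClass (cong (4 +_) (*-suc 4 n)) (4n+4 (suc n))
ResidueClass-4+ (4n+5 n) = subst ResidueClass (cong (5 +_) (*-suc 4 n)) (4n+5 (suc n))
ResidueClass-4+ (4n+2 n) = subst ResidueClass (cong (2 +_) (*-suc 4 n)) (4n+2 (suc n))
ResidueClass-4+ (4n+3 n) = subst ResidueClass (cong (3 +_) (*-suc 4 n)) (4n+3 (suc n))

residueClass : ∀ k → 1 ≤ k → ResidueClass k
residueClass 1 _ = one
residueClass 2 _ = 4n+2 0
residueClass 3 _ = 4n+3 0
residueClass 4 _ = 4n+4 0
residueClass (suc (suc (suc (suc (suc k))))) _ = ResidueClass-4+ (residueClass (suc k) (s≤s z≤n))

theorem8 : (k : ℕ) → 1 ≤ k → IsRR k (rrValue k)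
theorem8 k 1≤k with residueClass k 1≤k
... | one    = Case-1.isRR-rrValue
... | 4n+4 n = Case-4n+4.isRR-rrValue n
... | 4n+5 n = Case-4n+5.isRR-rrValue n
... | 4n+2 n = Case-4n+2.isRR-rrValue n
... | 4n+3 n = Case-4n+3.isRR-rrValue n
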